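{- Let $k$, $n$ and $x$ be positive integers. Then (i) $f_{k+1}(n)\le f_k(n)$; (ii) $f_k(n)\le f_k(n+x)$. Moreover, \[ f_k(n)\le f_k(n+x)-\Bigl\lceil \frac{x}{n+x}f_k(n+x)\Bigr\rceil\le\Bigl(1-\frac{x}{n+x}\Bigr)f_k(n+x). \]
   Context: An $n$-ary $k$-radius sequence is a finite sequence $a_0,\ldots,a_{m-1}$ of elements of $\{0,\ldots,n-1\}$ such that for all distinct $x,y$ in this set there exist $i,j$ with $a_i=x$, $a_j=y$, $|i-j|\le k$; $f_k(n)$ is the shortest length of such a sequence. -}

module Defs where

open import Data.Nat using (ℕ; zero; suc; _+_; _*_; _∸_; _≤_; ∣_-_∣)
open import Data.Nat.DivMod using (_/_)
open import Data.Fin using (Fin; toℕ)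
open import Data.Product using (Σ; _×_; ∃-syntax)
open import Relation.Binary.PropositionalEquality using (_≡_; _≢_)

Seq : ℕ → ℕ → Set
Seq n m = Fin m → Fin n

IsRadiusSeq : (k n m : ℕ) → Seq n m → Set
IsRadiusSeq k n m a =
  (x y : Fin n) → x ≢ y →
  ∃[ i ] ∃[ j ] (a i ≡ x × a j ≡ y × ∣ toℕ i - toℕ j ∣ ≤ k)

-- "f_k(n) = m": m is the shortest length of an n-ary k-radius sequence.
IsF : (k n m : ℕ) → Set
IsF k n m =
  (Σ (Seq n m) (IsRadiusSeq k n m)) ×
  (∀ m' → (a : Seq n m') → IsRadiusSeq k n m' a → m ≤ m')

-- Ceiling of a / b (b > 0); convention ⌈a/0⌉ = 0 (never used).
ceilDiv : ℕ → ℕ → ℕ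
ceilDiv a zero = zero
ceilDiv a (suc b) = (a + b) / suc b

module Submission where

-- (i) A k-radius sequence is also a (k+1)-radius sequence, so a shortest
--     (k+1)-radius sequence is no longer than a shortest k-radius one.
-- (ii) Deleting every occurrence of a symbol s from an (m+1)-ary k-radius
--     sequence, and renumbering the remaining symbols with punchOut s, gives
--     an m-ary k-radius sequence: surviving entries only move closer together.
--     The most frequent symbol occurs at least L/(m+1) times in a sequence of
--     length L, so deleting it leaves length at most m L/(m+1).  Repeating this
--     x times turns an optimal (n+x)-ary sequence of length F into an n-ary one
--     of length L with (n + x) L ≤ n F.  Then f_k(n) ≤ L, and the bounds with
--     the ceiling follow from two characterising properties of ceilDiv.
--
-- Since deletion changes the length, the deletion argument works with lists;
-- the first section translates between lists and the sequences of Defs.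

open import Defs

open import Data.Nat using (ℕ; zero; suc; _+_; _*_; _∸_; _≤_; _<_; ∣_-_∣; z≤n; s≤s; s≤s⁻¹; NonZero; >-nonZero)
open import Data.Nat.Properties
open import Algebra.Properties.CommutativeMonoid.Sum +-0-commutativeMonoid
  using (sum; sum-remove; ∑-distrib-+; sum-cong-≗; sum-replicate-zero)
open import Data.Nat.DivMod using (_%_; m≡m%n+[m/n]*n; m%n<n; m<n*o⇒m/o<n)
open import Data.Fin using (Fin; toℕ; punchIn; punchOut) renaming (zero to fzero; suc to fsuc; _≟_ to _≟ᶠ_)
open import Data.Fin.Properties using (punchOut-cong; punchOut-punchIn; punchInᵢ≢i; punchIn-injective)
open import Data.List using (List; []; _∷_; length; tabulate; lookup)
open import Data.List.Properties using (length-tabulate)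
open import Data.Product using (Σ; _×_; _,_; ∃-syntax)
open import Relation.Binary.PropositionalEquality
open import Relation.Nullary using (Dec; yes; no)
open import Relation.Nullary.Negation using (contradiction)
open import Function using (_∘_)

data OccursAt {A : Set} : List A → ℕ → A → Set where
  here  : ∀ {x xs} → OccursAt (x ∷ xs) 0 x
  there : ∀ {y xs i x} → OccursAt xs i x → OccursAt (y ∷ xs) (suc i) x

IsRadiusList : (k n : ℕ) → List (Fin n) → Set
IsRadiusList k n xs = (x y : Fin n) → x ≢ y →
  ∃[ i ] ∃[ j ] (OccursAt xs i x × OccursAt xs j y × ∣ i - j ∣ ≤ k)

occursAt-tabulate : ∀ {A : Set} {m} (a : Fin m → A) (i : Fin m) →
  OccursAt (tabulate a) (toℕ i) (a i)
occursAt-tabulate a fzero    = here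
occursAt-tabulate a (fsuc i) = there (occursAt-tabulate (a ∘ fsuc) i)

occursAt-lookup : ∀ {A : Set} {xs : List A} {i x} → OccursAt xs i x →
  Σ (Fin (length xs)) λ p → toℕ p ≡ i × lookup xs p ≡ x
occursAt-lookup here = fzero , refl , refl
occursAt-lookup (there occ) with occursAt-lookup occ
... | p , p≡i , xs[p]≡x = fsuc p , cong suc p≡i , xs[p]≡x

radiusSeq⇒radiusList : ∀ {k n m} (a : Seq n m) → IsRadiusSeq k n m a →
  IsRadiusList k n (tabulate a)
radiusSeq⇒radiusList a rad x y x≢y with rad x y x≢y
... | i , j , aᵢ≡x , aⱼ≡y , close =
  toℕ i , toℕ j ,
  subst (OccursAt _ _) aᵢ≡x (occursAt-tabulate a i) ,
  subst (OccursAt _ _) aⱼ≡y (occursAt-tabulate a j) ,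
  close

radiusList⇒radiusSeq : ∀ {k n} (xs : List (Fin n)) → IsRadiusList k n xs →
  IsRadiusSeq k n (length xs) (lookup xs)
radiusList⇒radiusSeq xs rad x y x≢y with rad x y x≢y
... | i , j , occ-x , occ-y , close with occursAt-lookup occ-x | occursAt-lookup occ-y
... | p , p≡i , xs[p]≡x | q , q≡j , xs[q]≡y =
  p , q , xs[p]≡x , xs[q]≡y ,
  subst₂ (λ u v → ∣ u - v ∣ ≤ _) (sym p≡i) (sym q≡j) close

radiusSeq-mono : ∀ {k k′ n m} (a : Seq n m) → k ≤ k′ →
  IsRadiusSeq k n m a → IsRadiusSeq k′ n m a
radiusSeq-mono a k≤k′ rad x y x≢y with rad x y x≢y
... | i , j , aᵢ≡x , aⱼ≡y , close = i , j , aᵢ≡x , aⱼ≡y , ≤-trans close k≤k′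

shortest-antitone : ∀ {k k′ n a b} → k ≤ k′ → IsF k′ n a → IsF k n b → a ≤ b
shortest-antitone k≤k′ (_ , a-least) ((s , s-rad) , _) =
  a-least _ s (radiusSeq-mono s k≤k′ s-rad)

delete : ∀ {m} → Fin (suc m) → List (Fin (suc m)) → List (Fin m)
delete s [] = []
delete s (e ∷ es) with s ≟ᶠ e
... | yes _   = delete s es
... | no s≢e  = punchOut s≢e ∷ delete s es

newPosition : ∀ {m} → Fin (suc m) → List (Fin (suc m)) → ℕ → ℕ
newPosition s []       i       = 0
newPosition s (e ∷ es) zero    = 0
newPosition s (e ∷ es) (suc i) with s ≟ᶠ e
... | yes _ = newPosition s es i
... | no _  = suc (newPosition s es i)

newPosition-≤ : ∀ {m} s (xs : List (Fin (suc m))) i → newPosition s xs i ≤ i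
newPosition-≤ s []       i       = z≤n
newPosition-≤ s (e ∷ es) zero    = z≤n
newPosition-≤ s (e ∷ es) (suc i) with s ≟ᶠ e
... | yes _ = m≤n⇒m≤1+n (newPosition-≤ s es i)
... | no _  = s≤s (newPosition-≤ s es i)

newPosition-nonexpansive : ∀ {m} s (xs : List (Fin (suc m))) i j →
  ∣ newPosition s xs i - newPosition s xs j ∣ ≤ ∣ i - j ∣
newPosition-nonexpansive s []       i       j       = z≤n
newPosition-nonexpansive s (e ∷ es) zero    zero    = z≤n
newPosition-nonexpansive s (e ∷ es) zero    (suc j) = newPosition-≤ s (e ∷ es) (suc j)
newPosition-nonexpansive s (e ∷ es) (suc i) zero
  rewrite ∣-∣-identityʳ (newPosition s (e ∷ es) (suc i)) = newPosition-≤ s (e ∷ es) (suc i)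
newPosition-nonexpansive s (e ∷ es) (suc i) (suc j) with s ≟ᶠ e
... | yes _ = newPosition-nonexpansive s es i j
... | no _  = newPosition-nonexpansive s es i j

occursAt-delete : ∀ {m} s (xs : List (Fin (suc m))) {i e} →
  OccursAt xs i e → (s≢e : s ≢ e) →
  OccursAt (delete s xs) (newPosition s xs i) (punchOut s≢e)
occursAt-delete s (e ∷ es) here s≢e with s ≟ᶠ e
... | yes s≡e = contradiction s≡e s≢e
... | no _    = subst (λ z → OccursAt (z ∷ delete s es) 0 (punchOut s≢e))
                      (punchOut-cong s refl) here
occursAt-delete s (y ∷ es) (there occ) s≢e with s ≟ᶠ y
... | yes _ = occursAt-delete s es occ s≢e
... | no _  = there (occursAt-delete s es occ s≢e)

delete-radius : ∀ {k m} s (xs : List (Fin (suc m))) →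
  IsRadiusList k (suc m) xs → IsRadiusList k m (delete s xs)
delete-radius s xs rad x y x≢y
  with rad (punchIn s x) (punchIn s y) (x≢y ∘ punchIn-injective s x y)
... | i , j , occ-x , occ-y , close =
  newPosition s xs i , newPosition s xs j ,
  survives x occ-x , survives y occ-y ,
  ≤-trans (newPosition-nonexpansive s xs i j) close
  where
  survives : ∀ z {p} → OccursAt xs p (punchIn s z) →
    OccursAt (delete s xs) (newPosition s xs p) z
  survives z occ = subst (OccursAt _ _) (punchOut-punchIn s)
                         (occursAt-delete s xs occ (punchInᵢ≢i s z ∘ sym))

indicator : ∀ {p} {P : Set p} → Dec P → ℕ
indicator (yes _) = 1
indicator (no _)  = 0

occurrences : ∀ {m} → Fin m → List (Fin m) → ℕ
occurrences t []       = 0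
occurrences t (e ∷ es) = indicator (t ≟ᶠ e) + occurrences t es

length-delete : ∀ {m} s (xs : List (Fin (suc m))) →
  length (delete s xs) + occurrences s xs ≡ length xs
length-delete s [] = refl
length-delete s (e ∷ es) with s ≟ᶠ e
... | yes _ = trans (+-suc _ _) (cong suc (length-delete s es))
... | no _  = cong suc (length-delete s es)

sum-indicator : ∀ {m} (e : Fin (suc m)) → sum (λ t → indicator (t ≟ᶠ e)) ≡ 1
sum-indicator {m} e = begin
  sum δ                         ≡⟨ sum-remove {i = e} δ ⟩
  δ e + sum (δ ∘ punchIn e)     ≡⟨ cong₂ _+_ at-e (sum-cong-≗ off-e) ⟩
  1 + sum (λ (_ : Fin m) → 0)   ≡⟨ cong suc (sum-replicate-zero m) ⟩
  1                             ∎
  where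
  open ≡-Reasoning
  δ : Fin (suc m) → ℕ
  δ t = indicator (t ≟ᶠ e)
  at-e : δ e ≡ 1
  at-e with e ≟ᶠ e
  ... | yes _   = refl
  ... | no e≢e  = contradiction refl e≢e
  off-e : ∀ j → δ (punchIn e j) ≡ 0
  off-e j with punchIn e j ≟ᶠ e
  ... | yes eq = contradiction eq (punchInᵢ≢i e j)
  ... | no _   = refl

sum-occurrences : ∀ {m} (xs : List (Fin (suc m))) →
  sum (λ t → occurrences t xs) ≡ length xs
sum-occurrences {m} [] = sum-replicate-zero (suc m)
sum-occurrences (e ∷ es) = begin
  sum (λ t → indicator (t ≟ᶠ e) + occurrences t es)
    ≡⟨ ∑-distrib-+ (λ t → indicator (t ≟ᶠ e)) (λ t → occurrences t es) ⟩
  sum (λ t → indicator (t ≟ᶠ e)) + sum (λ t → occurrences t es)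
    ≡⟨ cong₂ _+_ (sum-indicator e) (sum-occurrences es) ⟩
  suc (length es) ∎
  where open ≡-Reasoning

above-average : ∀ {m} (g : Fin (suc m) → ℕ) → ∃[ s ] sum g ≤ suc m * g s
above-average {zero} g = fzero , ≤-refl
above-average {suc m} g with above-average (g ∘ fsuc)
... | s , tail≤ with g fzero ≤? g (fsuc s)
... | yes g₀≤gₛ = fsuc s , +-mono-≤ g₀≤gₛ tail≤
... | no g₀≰gₛ  = fzero , +-monoʳ-≤ (g fzero)
                    (≤-trans tail≤ (*-monoʳ-≤ (suc m) (<⇒≤ (≰⇒> g₀≰gₛ))))

frequent-symbol : ∀ {m} (xs : List (Fin (suc m))) →
  ∃[ s ] length xs ≤ suc m * occurrences s xs
frequent-symbol {m} xs with above-average (λ t → occurrences t xs)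
... | s , bound = s , subst (_≤ suc m * occurrences s xs) (sum-occurrences xs) bound

delete-frequent : ∀ {k m} (xs : List (Fin (suc m))) → IsRadiusList k (suc m) xs →
  ∃[ ys ] (IsRadiusList k m ys × suc m * length ys ≤ m * length xs)
delete-frequent {m = m} xs rad with frequent-symbol xs
... | s , L≤ = delete s xs , delete-radius s xs rad ,
               +-cancelˡ-≤ L _ _ (begin
  L + suc m * y          ≤⟨ +-monoˡ-≤ (suc m * y) L≤ ⟩
  suc m * c + suc m * y  ≡⟨ sym (*-distribˡ-+ (suc m) c y) ⟩
  suc m * (c + y)        ≡⟨ cong (suc m *_) (trans (+-comm c y) (length-delete s xs)) ⟩
  suc m * L              ≡⟨⟩
  L + m * L              ∎)
  where
  open ≤-Reasoning
  L = length xs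
  c = occurrences s xs
  y = length (delete s xs)

delete-many : ∀ {k n} → 0 < n → ∀ j (xs : List (Fin (j + n))) →
  IsRadiusList k (j + n) xs →
  ∃[ ys ] (IsRadiusList k n ys × (j + n) * length ys ≤ n * length xs)
delete-many 0<n zero xs rad = xs , rad , ≤-refl
delete-many {n = n} 0<n (suc j) xs rad with delete-frequent xs rad
... | ys , ys-rad , ys-short with delete-many 0<n j ys ys-rad
... | zs , zs-rad , zs-short = zs , zs-rad , *-cancelˡ-≤ M (begin
  M * (suc M * z)  ≡⟨ *-comm-middle M (suc M) z ⟩
  suc M * (M * z)  ≤⟨ *-monoʳ-≤ (suc M) zs-short ⟩
  suc M * (n * y)  ≡⟨ *-comm-middle (suc M) n y ⟩
  n * (suc M * y)  ≤⟨ *-monoʳ-≤ n ys-short ⟩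
  n * (M * x)      ≡⟨ *-comm-middle n M x ⟩
  M * (n * x)      ∎)
  where
  open ≤-Reasoning
  M = j + n
  x = length xs
  y = length ys
  z = length zs
  instance
    M-nonZero : NonZero M
    M-nonZero = >-nonZero (≤-trans 0<n (m≤n+m n j))
  *-comm-middle : ∀ a b c → a * (b * c) ≡ b * (a * c)
  *-comm-middle a b c = trans (sym (*-assoc a b c))
                              (trans (cong (_* c) (*-comm a b)) (*-assoc b a c))

ceilDiv-sound : ∀ a b → a ≤ ceilDiv a (suc b) * suc b
ceilDiv-sound a b = +-cancelʳ-≤ b _ _ (begin
  a + b                    ≡⟨ m≡m%n+[m/n]*n (a + b) (suc b) ⟩
  (a + b) % suc b + c * N  ≤⟨ +-monoˡ-≤ (c * N) (s≤s⁻¹ (m%n<n (a + b) (suc b))) ⟩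
  b + c * N                ≡⟨ +-comm b (c * N) ⟩
  c * N + b                ∎)
  where
  open ≤-Reasoning
  N = suc b
  c = ceilDiv a N

ceilDiv-least : ∀ a b q → a ≤ q * suc b → ceilDiv a (suc b) ≤ q
ceilDiv-least a b q a≤qN = s≤s⁻¹ (m<n*o⇒m/o<n (begin-strict
  a + b      <⟨ +-monoʳ-< a (n<1+n b) ⟩
  a + suc b  ≤⟨ +-monoˡ-≤ (suc b) a≤qN ⟩
  q * suc b + suc b ≡⟨ +-comm (q * suc b) (suc b) ⟩
  suc q * suc b ∎))
  where open ≤-Reasoning

ceiling-bounds : ∀ n x F L → 0 < n → (n + x) * L ≤ n * F →
  (L ≤ F ∸ ceilDiv (x * F) (n + x)) ×
  ((n + x) * (F ∸ ceilDiv (x * F) (n + x)) ≤ n * F)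
ceiling-bounds (suc n′) x F L _ NL≤nF = L≤F∸c , N[F∸c]≤nF
  where
  n = suc n′
  N = n + x
  c = ceilDiv (x * F) N
  NF≡nF+xF : N * F ≡ n * F + x * F
  NF≡nF+xF = *-distribʳ-+ F n x
  L≤F : L ≤ F
  L≤F = *-cancelˡ-≤ N (≤-trans NL≤nF (≤-trans (m≤m+n (n * F) (x * F))
                                                (≤-reflexive (sym NF≡nF+xF))))
  xF≤[F∸L]N : x * F ≤ (F ∸ L) * N
  xF≤[F∸L]N = begin
    x * F              ≤⟨ m+n≤o⇒m≤o∸n (x * F) (begin
        x * F + L * N  ≤⟨ +-monoʳ-≤ (x * F) (≤-trans (≤-reflexive (*-comm L N)) NL≤nF) ⟩
        x * F + n * F  ≡⟨ trans (+-comm (x * F) (n * F)) (sym NF≡nF+xF) ⟩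
        N * F          ≡⟨ *-comm N F ⟩
        F * N          ∎) ⟩
    F * N ∸ L * N      ≡⟨ sym (*-distribʳ-∸ N F L) ⟩
    (F ∸ L) * N        ∎
    where open ≤-Reasoning
  L≤F∸c : L ≤ F ∸ c
  L≤F∸c = begin
    L              ≡⟨ sym (m∸[m∸n]≡n L≤F) ⟩
    F ∸ (F ∸ L)    ≤⟨ ∸-monoʳ-≤ F (ceilDiv-least (x * F) (n′ + x) (F ∸ L) xF≤[F∸L]N) ⟩
    F ∸ c          ∎
    where open ≤-Reasoning
  N[F∸c]≤nF : N * (F ∸ c) ≤ n * F
  N[F∸c]≤nF = begin
    N * (F ∸ c)    ≡⟨ *-distribˡ-∸ N F c ⟩
    N * F ∸ N * c  ≤⟨ ∸-monoʳ-≤ (N * F) (≤-trans (ceilDiv-sound (x * F) (n′ + x))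
                                                   (≤-reflexive (*-comm c N))) ⟩
    N * F ∸ x * F  ≡⟨ cong (_∸ x * F) NF≡nF+xF ⟩
    n * F + x * F ∸ x * F ≡⟨ m+n∸n≡m (n * F) (x * F) ⟩
    n * F          ∎
    where open ≤-Reasoning

shrink-optimal : ∀ {k n x a F} → 0 < n → IsF k n a → IsF k (n + x) F →
  ∃[ L ] (a ≤ L × (n + x) * L ≤ n * F)
shrink-optimal {k} {n} {x} {F = F} 0<n (_ , a-least) F-opt
  with subst (λ N → IsF k N F) (+-comm n x) F-opt
... | (s , s-rad) , _ with delete-many 0<n x (tabulate s) (radiusSeq⇒radiusList s s-rad)
... | ys , ys-rad , ys-short =
  length ys ,
  a-least _ (lookup ys) (radiusList⇒radiusSeq ys ys-rad) ,
  subst₂ (λ N G → N * length ys ≤ n * G) (+-comm x n) (length-tabulate s) ys-short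

lemma2p1 : (k n x : ℕ) → 0 < k → 0 < n → 0 < x →
    (∀ a b → IsF (k + 1) n a → IsF k n b → a ≤ b) ×
    (∀ a F → IsF k n a → IsF k (n + x) F →
      (a ≤ F) ×
      (a ≤ F ∸ ceilDiv (x * F) (n + x)) ×
      ((n + x) * (F ∸ ceilDiv (x * F) (n + x)) ≤ n * F))
lemma2p1 k n x _ 0<n _ =
  (λ a b → shortest-antitone (m≤m+n k 1)) , part-ii
  where
  part-ii : ∀ a F → IsF k n a → IsF k (n + x) F →
    (a ≤ F) ×
    (a ≤ F ∸ ceilDiv (x * F) (n + x)) ×
    ((n + x) * (F ∸ ceilDiv (x * F) (n + x)) ≤ n * F)
  part-ii a F a-opt F-opt with shrink-optimal 0<n a-opt F-opt
  ... | L , a≤L , NL≤nF with ceiling-bounds n x F L 0<n NL≤nF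
  ... | L≤F∸c , bound = ≤-trans a≤F∸c (m∸n≤m F (ceilDiv (x * F) (n + x))) , a≤F∸c , bound
    where
    a≤F∸c : a ≤ F ∸ ceilDiv (x * F) (n + x)
    a≤F∸c = ≤-trans a≤L L≤F∸c
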